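{- Let $G$ be an abelian group (written additively) of order $v$, and let $D\subseteq G$ be a $(v,k,\lambda,s)$ almost difference set in $G$. Let $Dev(D)=\{D+g\mid g\in G\}$, where $D+g=\{d+g\mid d\in D\}$. Then $(G,Dev(D))$ is a $2$-$(v,k,\lambda)$ adesign. Moreover, for all distinct $x,y\in G$, the number $r_{\{x,y\}}^{Dev(D)}$ of blocks of $Dev(D)$ containing both $x$ and $y$ satisfies \[ r_{\{x,y\}}^{Dev(D)}=\begin{cases}\lambda, & \text{if } |(D+x)\cap(D+y)|=\lambda,\\ \lambda+1, & \text{otherwise.}\end{cases} \]
   Context: A $(v,k,\lambda,s)$ almost difference set in a group $G$ of order $v$ is a $k$-subset $D\subseteq G$ such that the multiset $\{x-y\mid x,y\in D,\ x\neq y\}$ contains $s$ nonidentity elements of $G$ each with multiplicity $\lambda$, and the remaining $v-1-s$ nonidentity elements each with multiplicity $\lambda+1$ (a difference set is regarded as the case $s=0$ or $s=v-1$). An incidence structure $(V,\mathcal{B})$ consists of a finite point set $V$ and a collection $\mathcal{B}$ of subsets (blocks) of $V$, with incidence given by membership. A $t$-$(v,k,\lambda)$ design ($0<t<k<v$) is an incidence structure with $|V|=v$, all blocks of size $k$, and every $t$-subset of $V$ contained in exactly $\lambda$ blocks. A $t$-$(v,k,\lambda)$ adesign is an incidence structure with $|V|=v$, all blocks of size $k$, such that for a positive integer $\lambda$ every $t$-subset of $V$ is contained in either $\lambda$ or $\lambda+1$ blocks, and which is not a $t$-design. -}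

module Defs where

open import Level using (0ℓ)
open import Data.Nat using (ℕ; suc; _<_; _∸_)
open import Data.Fin using (Fin; _≟_)
open import Data.Fin.Subset using (Subset; _∈_; _⊆_; ∣_∣; _∩_)
open import Data.Fin.Subset.Properties using (_∈?_; _⊆?_)
open import Data.Fin.Properties using (any?)
open import Data.List using (List; length; filter; allFin; cartesianProduct)
open import Data.Product using (Σ; _×_; _,_; proj₁; proj₂)
open import Data.Sum using (_⊎_)
open import Data.Vec using (tabulate)
open import Relation.Nullary using (¬_; Dec; does; ¬?)
open import Relation.Nullary.Decidable using (_×-dec_)
open import Relation.Unary using (Pred; Decidable)
open import Relation.Binary.PropositionalEquality using (_≡_; _≢_)
import Data.Nat as ℕ
open import Algebra.Structures using (IsAbelianGroup)

-- A finite abelian group of order v, presented on the carrier Fin v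
-- (every group of order v is isomorphic to one of this form), with
-- propositional equality.

record FinAbGroup (v : ℕ) : Set where
  field
    _+_    : Fin v → Fin v → Fin v
    0#     : Fin v
    -_     : Fin v → Fin v
    isAbelianGroup : IsAbelianGroup _≡_ _+_ 0# -_

  _-_ : Fin v → Fin v → Fin v
  x - y = x + (- y)

count : ∀ {v} {P : Pred (Fin v) 0ℓ} → Decidable P → ℕ
count {v} P? = length (filter P? (allFin v))

countPairs : ∀ {v} {P : Pred (Fin v × Fin v) 0ℓ} → Decidable P → ℕ
countPairs {v} P? = length (filter P? (cartesianProduct (allFin v) (allFin v)))

module _ {v : ℕ} (G : FinAbGroup v) where
  open FinAbGroup G

  diffMult : Subset v → Fin v → ℕ
  diffMult D h = countPairs {P = λ p → (proj₁ p ∈ D × proj₂ p ∈ D) × (proj₁ p ≢ proj₂ p × (proj₁ p - proj₂ p) ≡ h)}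
    (λ p → ((proj₁ p ∈? D) ×-dec (proj₂ p ∈? D)) ×-dec (¬? (proj₁ p ≟ proj₂ p) ×-dec ((proj₁ p - proj₂ p) ≟ h)))

  -- D is a (v,k,λ,s) almost difference set in G.
  -- Reading: the genuine case 0 < s < v-1 (s = 0 or s = v-1 are
  -- difference sets, treated separately).
  IsADS : Subset v → ℕ → ℕ → ℕ → Set
  IsADS D k lam s =
      ∣ D ∣ ≡ k
    × 0 ℕ.< s × s ℕ.< v ∸ 1
    × count {P = λ h → h ≢ 0# × diffMult D h ≡ lam} (λ h → ¬? (h ≟ 0#) ×-dec (diffMult D h ℕ.≟ lam)) ≡ s
    × (∀ h → h ≢ 0# → diffMult D h ≡ lam ⊎ diffMult D h ≡ suc lam)

  translate : Subset v → Fin v → Subset v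
  translate D g = tabulate (λ x → does (any? {P = λ d → d ∈ D × x ≡ d + g} (λ d → (d ∈? D) ×-dec (x ≟ (d + g)))))

  Dev : Subset v → Fin v → Subset v
  Dev D g = translate D g

-- Incidence structures (Fin v, B) with blocks B : Fin b → Subset v
-- (a collection of blocks, repetitions allowed)

module _ {v b : ℕ} (B : Fin b → Subset v) where

  blocksContaining : Subset v → ℕ
  blocksContaining T = count {P = λ i → T ⊆ B i} (λ i → T ⊆? B i)

  r₂ : Fin v → Fin v → ℕ
  r₂ x y = count {P = λ i → x ∈ B i × y ∈ B i} (λ i → (x ∈? B i) ×-dec (y ∈? B i))

  IsDesign : ℕ → ℕ → ℕ → Set
  IsDesign t k lam =
      (∀ i → ∣ B i ∣ ≡ k)
    × 0 ℕ.< t × t ℕ.< k × k ℕ.< v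
    × (∀ (T : Subset v) → ∣ T ∣ ≡ t → blocksContaining T ≡ lam)

  IsAdesign : ℕ → ℕ → ℕ → Set
  IsAdesign t k lam =
      (∀ i → ∣ B i ∣ ≡ k)
    × 0 ℕ.< t × t ℕ.< k × k ℕ.< v
    × 0 ℕ.< lam
    × (∀ (T : Subset v) → ∣ T ∣ ≡ t → blocksContaining T ≡ lam ⊎ blocksContaining T ≡ suc lam)
    × ¬ (Σ ℕ (λ μ → IsDesign t k μ))

-- Everything is governed by the difference function δ(h) = #{d ∈ D ∣ d - h ∈ D} = ∣D ∩ (D + h)∣.
-- Reindexing sums by the bijections g ↦ x - g and z ↦ z + y shows that the number of blocks
-- D + g through x and y and the size of (D + x) ∩ (D + y) both equal δ(x - y), and for h ≠ 0
-- δ(h) is the multiplicity of h as a difference of D.  Hence pairs of points lie in λ or λ + 1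
-- blocks, and both values occur because 0 < s < v - 1, so Dev(D) is not a design.  Finally
-- Σ_h δ(h) = k², δ(0) = k and the two nonzero values λ ≥ 1 and λ + 1 give k² ≥ k + 3, so k > 2,
-- while D = G would make δ constant, so k < v.

module Submission where

open import Defs
open import Level using (0ℓ)
import Data.Nat as ℕ
open import Data.Nat using (ℕ; zero; suc; _+_; _*_; _∸_; _≤_; _<_; z≤n; s≤s)
open import Data.Nat.Properties
  using (+-identityʳ; +-assoc; +-mono-≤; +-monoʳ-≤; *-identityˡ; *-distribʳ-+; *-monoˡ-≤;
         ≤-trans; <-irrefl; ≤∧≢⇒<; <⇒≢; n<1+n; suc-injective; +-*-semiring; module ≤-Reasoning)
open import Data.Fin using (Fin; zero; suc; _≟_; punchIn)
open import Data.Fin.Properties using (punchInᵢ≢i; any?)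
open import Data.Fin.Permutation using (permutation)
open import Data.Fin.Subset using (Subset; _∈_; _⊆_; _∩_; _∪_; ∣_∣; inside; outside; ⊥; ⁅_⁆)
open import Data.Fin.Subset.Properties
  using (_∈?_; _⊆?_; drop-there; ∈⊤; ∩⇔×; x∈p∪q⁺; x∈p∪q⁻; x∈⁅x⁆; x∈⁅y⁆⇒x≡y; ∣⁅x⁆∣≡1;
         ∪-identityˡ; ∪-identityʳ; ∣p∣≤n; ∣p∣≡n⇒p≡⊤)
open import Data.List using (length; filter; map; tabulate; cartesianProduct; _++_)
open import Data.List.Properties using (filter-++; length-++; map-tabulate)
open import Data.Vec using ([]; _∷_; there)
import Data.Vec as Vec
open import Data.Vec.Properties using (lookup∘tabulate; []=⇒lookup; lookup⇒[]=)
open import Data.Product using (Σ; _×_; _,_; ∃; ∃₂; proj₁; proj₂; swap)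
open import Data.Product.Function.NonDependent.Propositional using (_×-⇔_)
open import Data.Sum using (_⊎_; inj₁; inj₂; [_,_]′)
import Data.Sum as Sum
open import Function using (_∘_; flip; id; _⇔_; mk⇔; Equivalence)
open import Function.Construct.Composition using (_⇔-∘_)
open import Relation.Nullary using (Dec; yes; no; ¬_; ¬?; does; contradiction)
open import Relation.Nullary.Decidable using (_×-dec_; dec-true; decidable-stable)
open import Relation.Unary using (Pred; Decidable)
open import Relation.Binary.PropositionalEquality
open import Algebra.Bundles using (AbelianGroup)
import Algebra.Properties.AbelianGroup as AbelianGroupProperties
open import Algebra.Properties.Semiring.Sum +-*-semiring
  using (sum; sum-syntax; sum-cong-≗; sum-remove; sum-replicate-zero; sum-permute; ∑-distrib-+; ∑-comm;
         *-distribˡ-sum; *-distribʳ-sum)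

-- Indicators and finite sums

𝟙 : ∀ {p} {P : Set p} → Dec P → ℕ
𝟙 (yes _) = 1
𝟙 (no _)  = 0

module _ {P Q : Set} where

  𝟙-cong : P ⇔ Q → (p : Dec P) (q : Dec Q) → 𝟙 p ≡ 𝟙 q
  𝟙-cong _   (yes _) (yes _) = refl
  𝟙-cong P⇔Q (yes p) (no ¬q) = contradiction (Equivalence.to P⇔Q p) ¬q
  𝟙-cong P⇔Q (no ¬p) (yes q) = contradiction (Equivalence.from P⇔Q q) ¬p
  𝟙-cong _   (no _)  (no _)  = refl

  𝟙-× : (p : Dec P) (q : Dec Q) → 𝟙 (p ×-dec q) ≡ 𝟙 p * 𝟙 q
  𝟙-× (yes _) (yes _) = refl
  𝟙-× (yes _) (no _)  = refl
  𝟙-× (no _)  _       = refl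

module _ {P : Set} where

  𝟙-yes : (p : Dec P) → P → 𝟙 p ≡ 1
  𝟙-yes (yes _) _  = refl
  𝟙-yes (no ¬x) x = contradiction x ¬x

  𝟙-no : (p : Dec P) → ¬ P → 𝟙 p ≡ 0
  𝟙-no (yes x) ¬x = contradiction x ¬x
  𝟙-no (no _)  _  = refl

  𝟙+𝟙-¬≡1 : (p : Dec P) → 𝟙 p + 𝟙 (¬? p) ≡ 1
  𝟙+𝟙-¬≡1 (yes _) = refl
  𝟙+𝟙-¬≡1 (no _)  = refl

∑-mono-≤ : ∀ {n} {f g : Fin n → ℕ} → (∀ i → f i ≤ g i) → sum f ≤ sum g
∑-mono-≤ {zero}  f≤g = z≤n
∑-mono-≤ {suc n} f≤g = +-mono-≤ (f≤g zero) (∑-mono-≤ (f≤g ∘ suc))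

∑-const-1 : ∀ n → ∑[ i < n ] 1 ≡ n
∑-const-1 zero    = refl
∑-const-1 (suc n) = cong suc (∑-const-1 n)

∑-zero : ∀ {n} {f : Fin n → ℕ} → (∀ i → f i ≡ 0) → sum f ≡ 0
∑-zero {n} f≡0 = trans (sum-cong-≗ f≡0) (sum-replicate-zero n)

∑-single : ∀ {n} (f : Fin n → ℕ) i → (∀ j → j ≢ i → f j ≡ 0) → sum f ≡ f i
∑-single {suc n} f i f≡0 = begin
  sum f                                   ≡⟨ sum-remove f ⟩
  f i + ∑[ j < n ] f (punchIn i j)        ≡⟨ cong (f i +_) (∑-zero (λ j → f≡0 _ (punchInᵢ≢i i j))) ⟩
  f i + 0                                 ≡⟨ +-identityʳ (f i) ⟩
  f i                                     ∎
  where open ≡-Reasoning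

∑-≥-three-points : ∀ {n} (f : Fin n → ℕ) {a b c : Fin n} → a ≢ b → a ≢ c → b ≢ c →
  f a + f b + f c ≤ sum f
∑-≥-three-points {n} f {a} {b} {c} a≢b a≢c b≢c = begin
  f a + f b + f c                                ≡⟨ cong₂ _+_ (cong₂ _+_ (∑-at a) (∑-at b)) (∑-at c) ⟨
  sum (at a) + sum (at b) + sum (at c)           ≡⟨ cong (_+ sum (at c)) (∑-distrib-+ (at a) (at b)) ⟨
  ∑[ i < n ] (at a i + at b i) + sum (at c)      ≡⟨ ∑-distrib-+ (λ i → at a i + at b i) (at c) ⟨
  ∑[ i < n ] (at a i + at b i + at c i)          ≤⟨ ∑-mono-≤ at≤f ⟩
  sum f                                          ∎
  where
  open ≤-Reasoning

  at : Fin n → Fin n → ℕ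
  at p i = 𝟙 (i ≟ p) * f i

  ∑-at : ∀ p → sum (at p) ≡ f p
  ∑-at p = trans (∑-single (at p) p (λ i i≢p → cong (_* f i) (𝟙-no (i ≟ p) i≢p)))
                 (trans (cong (_* f p) (𝟙-yes (p ≟ p) refl)) (*-identityˡ (f p)))

  at-most-one : ∀ i → 𝟙 (i ≟ a) + 𝟙 (i ≟ b) + 𝟙 (i ≟ c) ≤ 1
  at-most-one i with i ≟ a | i ≟ b | i ≟ c
  ... | yes refl | yes refl | _        = contradiction refl a≢b
  ... | yes refl | no _     | yes refl = contradiction refl a≢c
  ... | no _     | yes refl | yes refl = contradiction refl b≢c
  ... | yes _    | no _     | no _     = s≤s z≤n
  ... | no _     | yes _    | no _     = s≤s z≤n
  ... | no _     | no _     | yes _    = s≤s z≤n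
  ... | no _     | no _     | no _     = z≤n

  at≤f : ∀ i → at a i + at b i + at c i ≤ f i
  at≤f i = begin
    𝟙 (i ≟ a) * f i + 𝟙 (i ≟ b) * f i + 𝟙 (i ≟ c) * f i
      ≡⟨ cong (_+ 𝟙 (i ≟ c) * f i) (*-distribʳ-+ (f i) (𝟙 (i ≟ a)) (𝟙 (i ≟ b))) ⟨
    (𝟙 (i ≟ a) + 𝟙 (i ≟ b)) * f i + 𝟙 (i ≟ c) * f i
      ≡⟨ *-distribʳ-+ (f i) (𝟙 (i ≟ a) + 𝟙 (i ≟ b)) (𝟙 (i ≟ c)) ⟨
    (𝟙 (i ≟ a) + 𝟙 (i ≟ b) + 𝟙 (i ≟ c)) * f i
      ≤⟨ *-monoˡ-≤ (f i) (at-most-one i) ⟩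
    1 * f i
      ≡⟨ *-identityˡ (f i) ⟩
    f i ∎

module _ {A : Set} {P : Pred A 0ℓ} (P? : Decidable P) where

  length-filter-tabulate : ∀ {n} (f : Fin n → A) →
    length (filter P? (tabulate f)) ≡ ∑[ i < n ] 𝟙 (P? (f i))
  length-filter-tabulate {zero}  f = refl
  length-filter-tabulate {suc n} f with P? (f zero)
  ... | yes _ = cong suc (length-filter-tabulate (f ∘ suc))
  ... | no _  = length-filter-tabulate (f ∘ suc)

module _ {A B : Set} {P : Pred (A × B) 0ℓ} (P? : Decidable P) where

  length-filter-cartesianProduct : ∀ {m n} (f : Fin m → A) (g : Fin n → B) →
    length (filter P? (cartesianProduct (tabulate f) (tabulate g)))
      ≡ ∑[ i < m ] ∑[ j < n ] 𝟙 (P? (f i , g j))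
  length-filter-cartesianProduct {zero}      f g = refl
  length-filter-cartesianProduct {suc m} {n} f g = begin
    length (filter P? (map (f zero ,_) (tabulate g) ++ rest))
      ≡⟨ cong length (filter-++ P? (map (f zero ,_) (tabulate g)) rest) ⟩
    length (filter P? (map (f zero ,_) (tabulate g)) ++ filter P? rest)
      ≡⟨ length-++ (filter P? (map (f zero ,_) (tabulate g))) ⟩
    length (filter P? (map (f zero ,_) (tabulate g))) + length (filter P? rest)
      ≡⟨ cong₂ _+_ (trans (cong (length ∘ filter P?) (map-tabulate g (f zero ,_)))
                          (length-filter-tabulate P? ((f zero ,_) ∘ g)))
                   (length-filter-cartesianProduct (f ∘ suc) g) ⟩
    ∑[ j < n ] 𝟙 (P? (f zero , g j)) + ∑[ i < m ] ∑[ j < n ] 𝟙 (P? (f (suc i) , g j))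
      ∎
    where
    open ≡-Reasoning
    rest = cartesianProduct (tabulate (f ∘ suc)) (tabulate g)

module _ {n : ℕ} {P : Pred (Fin n) 0ℓ} (P? : Decidable P) where

  count≡∑𝟙 : count P? ≡ ∑[ i < n ] 𝟙 (P? i)
  count≡∑𝟙 = length-filter-tabulate P? (λ i → i)

  ∑𝟙-witness : 0 < ∑[ i < n ] 𝟙 (P? i) → ∃ P
  ∑𝟙-witness 0<∑ with any? P?
  ... | yes ∃P = ∃P
  ... | no ∄P  = contradiction (sym (∑-zero (λ i → 𝟙-no (P? i) (∄P ∘ (i ,_))))) (<⇒≢ 0<∑)

  ∑𝟙+∑𝟙-¬≡n : ∑[ i < n ] 𝟙 (P? i) + ∑[ i < n ] 𝟙 (¬? (P? i)) ≡ n
  ∑𝟙+∑𝟙-¬≡n = begin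
    ∑[ i < n ] 𝟙 (P? i) + ∑[ i < n ] 𝟙 (¬? (P? i)) ≡⟨ ∑-distrib-+ (λ i → 𝟙 (P? i)) (λ i → 𝟙 (¬? (P? i))) ⟨
    ∑[ i < n ] (𝟙 (P? i) + 𝟙 (¬? (P? i)))          ≡⟨ sum-cong-≗ (λ i → 𝟙+𝟙-¬≡1 (P? i)) ⟩
    ∑[ i < n ] 1                                    ≡⟨ ∑-const-1 n ⟩
    n                                               ∎
    where open ≡-Reasoning

countPairs≡∑∑𝟙 : ∀ {n} {P : Pred (Fin n × Fin n) 0ℓ} (P? : Decidable P) →
  countPairs P? ≡ ∑[ i < n ] ∑[ j < n ] 𝟙 (P? (i , j))
countPairs≡∑∑𝟙 P? = length-filter-cartesianProduct P? (λ i → i) (λ j → j)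

∑𝟙-cong : ∀ {n} {P Q : Pred (Fin n) 0ℓ} → (∀ i → P i ⇔ Q i) → (P? : Decidable P) (Q? : Decidable Q) →
  ∑[ i < n ] 𝟙 (P? i) ≡ ∑[ i < n ] 𝟙 (Q? i)
∑𝟙-cong P⇔Q P? Q? = sum-cong-≗ (λ i → 𝟙-cong (P⇔Q i) (P? i) (Q? i))

count-cong : ∀ {n} {P Q : Pred (Fin n) 0ℓ} → (∀ i → P i ⇔ Q i) → (P? : Decidable P) (Q? : Decidable Q) →
  count P? ≡ count Q?
count-cong P⇔Q P? Q? = trans (count≡∑𝟙 P?) (trans (∑𝟙-cong P⇔Q P? Q?) (sym (count≡∑𝟙 Q?)))

∑𝟙-≢≡n∸1 : ∀ {n} (c : Fin n) → ∑[ i < n ] 𝟙 (¬? (i ≟ c)) ≡ n ∸ 1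
∑𝟙-≢≡n∸1 {n} c = cong (_∸ 1) (begin
  1 + ∑[ i < n ] 𝟙 (¬? (i ≟ c))                     ≡⟨ cong (_+ ∑[ i < n ] 𝟙 (¬? (i ≟ c))) ∑𝟙-≟≡1 ⟨
  ∑[ i < n ] 𝟙 (i ≟ c) + ∑[ i < n ] 𝟙 (¬? (i ≟ c))  ≡⟨ ∑𝟙+∑𝟙-¬≡n (_≟ c) ⟩
  n                                                 ∎)
  where
  open ≡-Reasoning

  ∑𝟙-≟≡1 : ∑[ i < n ] 𝟙 (i ≟ c) ≡ 1
  ∑𝟙-≟≡1 = trans (∑-single (λ i → 𝟙 (i ≟ c)) c (λ i → 𝟙-no (i ≟ c))) (𝟙-yes (c ≟ c) refl)

∑𝟙-∈-tail : ∀ {n} s (p : Subset n) → ∑[ i < n ] 𝟙 (i ∈? p) ≡ ∑[ i < n ] 𝟙 (suc i ∈? (s ∷ p))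
∑𝟙-∈-tail s p = ∑𝟙-cong (λ _ → mk⇔ there drop-there) (_∈? p) (λ i → suc i ∈? (s ∷ p))

∣p∣≡∑𝟙 : ∀ {n} (p : Subset n) → ∣ p ∣ ≡ ∑[ i < n ] 𝟙 (i ∈? p)
∣p∣≡∑𝟙 []            = refl
∣p∣≡∑𝟙 (inside  ∷ p) = cong suc (trans (∣p∣≡∑𝟙 p) (∑𝟙-∈-tail inside p))
∣p∣≡∑𝟙 (outside ∷ p) = trans (∣p∣≡∑𝟙 p) (∑𝟙-∈-tail outside p)

∈-tabulate-does⇔ : ∀ {n} {P : Pred (Fin n) 0ℓ} (P? : Decidable P) {x} →
  x ∈ Vec.tabulate (λ i → does (P? i)) ⇔ P x
∈-tabulate-does⇔ {P = P} P? {x} = mk⇔ to from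
  where
  to : x ∈ Vec.tabulate (λ i → does (P? i)) → P x
  to x∈ with P? x | trans (sym (lookup∘tabulate (λ i → does (P? i)) x)) ([]=⇒lookup x∈)
  ... | yes Px | _ = Px
  ... | no _   | ()

  from : P x → x ∈ Vec.tabulate (λ i → does (P? i))
  from Px = lookup⇒[]= x _ (trans (lookup∘tabulate (λ i → does (P? i)) x) (dec-true (P? x) Px))

-- Two-element subsets and the blocks through them

∣p∣≡0⇒p≡⊥ : ∀ {n} (p : Subset n) → ∣ p ∣ ≡ 0 → p ≡ ⊥
∣p∣≡0⇒p≡⊥ []            _   = refl
∣p∣≡0⇒p≡⊥ (outside ∷ p) ∣p∣≡0 = cong (outside ∷_) (∣p∣≡0⇒p≡⊥ p ∣p∣≡0)

∣p∣≡1⇒p≡⁅x⁆ : ∀ {n} (p : Subset n) → ∣ p ∣ ≡ 1 → ∃ λ x → p ≡ ⁅ x ⁆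
∣p∣≡1⇒p≡⁅x⁆ (inside  ∷ p) ∣p∣≡1 = zero , cong (inside ∷_) (∣p∣≡0⇒p≡⊥ p (suc-injective ∣p∣≡1))
∣p∣≡1⇒p≡⁅x⁆ (outside ∷ p) ∣p∣≡1 with ∣p∣≡1⇒p≡⁅x⁆ p ∣p∣≡1
... | x , p≡⁅x⁆ = suc x , cong (outside ∷_) p≡⁅x⁆

∣p∣≡2⇒p≡⁅x⁆∪⁅y⁆ : ∀ {n} (p : Subset n) → ∣ p ∣ ≡ 2 → ∃₂ λ x y → x ≢ y × p ≡ ⁅ x ⁆ ∪ ⁅ y ⁆
∣p∣≡2⇒p≡⁅x⁆∪⁅y⁆ (inside  ∷ p) ∣p∣≡2 with ∣p∣≡1⇒p≡⁅x⁆ p (suc-injective ∣p∣≡2)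
... | y , p≡⁅y⁆ = zero , suc y , (λ ()) , cong (inside ∷_) (trans p≡⁅y⁆ (sym (∪-identityˡ ⁅ y ⁆)))
∣p∣≡2⇒p≡⁅x⁆∪⁅y⁆ (outside ∷ p) ∣p∣≡2 with ∣p∣≡2⇒p≡⁅x⁆∪⁅y⁆ p ∣p∣≡2
... | x , y , x≢y , p≡⁅x⁆∪⁅y⁆ =
  suc x , suc y , (λ { refl → x≢y refl }) , cong (outside ∷_) p≡⁅x⁆∪⁅y⁆

∣⁅x⁆∪⁅y⁆∣≡2 : ∀ {n} {x y : Fin n} → x ≢ y → ∣ ⁅ x ⁆ ∪ ⁅ y ⁆ ∣ ≡ 2
∣⁅x⁆∪⁅y⁆∣≡2 {x = zero}  {zero}  x≢y = contradiction refl x≢y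
∣⁅x⁆∪⁅y⁆∣≡2 {x = zero}  {suc y} _   = cong suc (trans (cong ∣_∣ (∪-identityˡ ⁅ y ⁆)) (∣⁅x⁆∣≡1 y))
∣⁅x⁆∪⁅y⁆∣≡2 {x = suc x} {zero}  _   = cong suc (trans (cong ∣_∣ (∪-identityʳ ⁅ x ⁆)) (∣⁅x⁆∣≡1 x))
∣⁅x⁆∪⁅y⁆∣≡2 {x = suc x} {suc y} x≢y = ∣⁅x⁆∪⁅y⁆∣≡2 (x≢y ∘ cong suc)

⁅x⁆∪⁅y⁆⊆p⇔x,y∈p : ∀ {n} {x y : Fin n} {p : Subset n} → ⁅ x ⁆ ∪ ⁅ y ⁆ ⊆ p ⇔ (x ∈ p × y ∈ p)
⁅x⁆∪⁅y⁆⊆p⇔x,y∈p {x = x} {y} = mk⇔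
  (λ ⊆p → ⊆p (x∈p∪q⁺ (inj₁ (x∈⁅x⁆ x))) , ⊆p (x∈p∪q⁺ (inj₂ (x∈⁅x⁆ y))))
  (λ { (x∈p , y∈p) z∈ → [ (λ z∈⁅x⁆ → subst (_∈ _) (sym (x∈⁅y⁆⇒x≡y x z∈⁅x⁆)) x∈p)
                        , (λ z∈⁅y⁆ → subst (_∈ _) (sym (x∈⁅y⁆⇒x≡y y z∈⁅y⁆)) y∈p)
                        ]′ (x∈p∪q⁻ ⁅ x ⁆ ⁅ y ⁆ z∈) })

blocksContaining-⁅x⁆∪⁅y⁆ : ∀ {v b} (B : Fin b → Subset v) (x y : Fin v) →
  blocksContaining B (⁅ x ⁆ ∪ ⁅ y ⁆) ≡ r₂ B x y
blocksContaining-⁅x⁆∪⁅y⁆ B x y =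
  count-cong (λ _ → ⁅x⁆∪⁅y⁆⊆p⇔x,y∈p) (λ i → ⁅ x ⁆ ∪ ⁅ y ⁆ ⊆? B i) (λ i → (x ∈? B i) ×-dec (y ∈? B i))

blocksContaining-2-subset : ∀ {v b} (B : Fin b → Subset v) T → ∣ T ∣ ≡ 2 →
  ∃₂ λ x y → x ≢ y × blocksContaining B T ≡ r₂ B x y
blocksContaining-2-subset B T ∣T∣≡2 with ∣p∣≡2⇒p≡⁅x⁆∪⁅y⁆ T ∣T∣≡2
... | x , y , x≢y , refl = x , y , x≢y , blocksContaining-⁅x⁆∪⁅y⁆ B x y

k+3≤k*k⇒2<k : ∀ k → k + 3 ≤ k * k → 2 < k
k+3≤k*k⇒2<k 0 ()
k+3≤k*k⇒2<k 1 (s≤s ())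
k+3≤k*k⇒2<k 2 (s≤s (s≤s (s≤s (s≤s ()))))
k+3≤k*k⇒2<k (suc (suc (suc k))) _ = s≤s (s≤s (s≤s z≤n))

-- Translates of a subset of a finite abelian group

module _ {v : ℕ} (G : FinAbGroup v) where
  open FinAbGroup G renaming (_+_ to infixl 6 _⊕_; _-_ to infixl 6 _⊖_; -_ to ⊝_)

  abelianGroup : AbelianGroup 0ℓ 0ℓ
  abelianGroup = record { isAbelianGroup = isAbelianGroup }

  open AbelianGroup abelianGroup using (assoc; comm; identityʳ; inverseʳ)
  open AbelianGroupProperties abelianGroup
    using (xyx⁻¹≈y; ⁻¹-anti-homo‿-; //-rightDividesˡ; //-rightDividesʳ; x∙y⁻¹≈ε⇒x≈y; ε⁻¹≈ε)

  x⊖[x⊖y]≡y : ∀ x y → x ⊖ (x ⊖ y) ≡ y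
  x⊖[x⊖y]≡y x y = begin
    x ⊕ ⊝ (x ⊖ y)   ≡⟨ cong (x ⊕_) (⁻¹-anti-homo‿- x y) ⟩
    x ⊕ (y ⊖ x)     ≡⟨ assoc x y (⊝ x) ⟨
    x ⊕ y ⊖ x       ≡⟨ xyx⁻¹≈y x y ⟩
    y               ∎
    where open ≡-Reasoning

  [x⊕y]⊖z≡x⊖[z⊖y] : ∀ x y z → x ⊕ y ⊖ z ≡ x ⊖ (z ⊖ y)
  [x⊕y]⊖z≡x⊖[z⊖y] x y z = begin
    x ⊕ y ⊖ z       ≡⟨ assoc x y (⊝ z) ⟩
    x ⊕ (y ⊖ z)     ≡⟨ cong (x ⊕_) (⁻¹-anti-homo‿- z y) ⟨
    x ⊖ (z ⊖ y)     ∎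
    where open ≡-Reasoning

  y⊖[z⊖x]≡x⊖[z⊖y] : ∀ x y z → y ⊖ (z ⊖ x) ≡ x ⊖ (z ⊖ y)
  y⊖[z⊖x]≡x⊖[z⊖y] x y z = begin
    y ⊖ (z ⊖ x)     ≡⟨ [x⊕y]⊖z≡x⊖[z⊖y] y x z ⟨
    y ⊕ x ⊖ z       ≡⟨ cong (_⊖ z) (comm y x) ⟩
    x ⊕ y ⊖ z       ≡⟨ [x⊕y]⊖z≡x⊖[z⊖y] x y z ⟩
    x ⊖ (z ⊖ y)     ∎
    where open ≡-Reasoning

  x≢y⇒x⊖y≢0# : ∀ {x y} → x ≢ y → x ⊖ y ≢ 0#
  x≢y⇒x⊖y≢0# {x} {y} x≢y = x≢y ∘ x∙y⁻¹≈ε⇒x≈y x y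

  x⊖0≡x : ∀ x → x ⊖ 0# ≡ x
  x⊖0≡x x = trans (cong (x ⊕_) ε⁻¹≈ε) (identityʳ x)

  ∑-reflect : ∀ a (f : Fin v → ℕ) → sum f ≡ ∑[ i < v ] f (a ⊖ i)
  ∑-reflect a f = sum-permute f (permutation (a ⊖_) (a ⊖_) (x⊖[x⊖y]≡y a) (x⊖[x⊖y]≡y a))

  ∑-shift : ∀ a (f : Fin v → ℕ) → sum f ≡ ∑[ i < v ] f (i ⊕ a)
  ∑-shift a f = sum-permute f (permutation (_⊕ a) (_⊖ a) (//-rightDividesˡ a) (//-rightDividesʳ a))

  ∈-translate⇔ : ∀ {D x g} → x ∈ translate G D g ⇔ x ⊖ g ∈ D
  ∈-translate⇔ {D} {x} {g} = mk⇔
    (λ x∈ → let d , d∈D , x≡d⊕g = Equivalence.to (∈-tabulate-does⇔ ∈D⊕g?) x∈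
            in subst (_∈ D) (sym (trans (cong (_⊖ g) x≡d⊕g) (//-rightDividesʳ g d))) d∈D)
    (λ x⊖g∈D → Equivalence.from (∈-tabulate-does⇔ ∈D⊕g?)
                 (x ⊖ g , x⊖g∈D , sym (//-rightDividesˡ g x)))
    where
    ∈D⊕g? : Decidable (λ y → ∃ λ d → d ∈ D × y ≡ d ⊕ g)
    ∈D⊕g? y = any? (λ d → (d ∈? D) ×-dec (y ≟ (d ⊕ g)))

  module _ (D : Subset v) where

    bothIn : Fin v → Fin v → ℕ
    bothIn a b = 𝟙 ((a ∈? D) ×-dec (b ∈? D))

    bothIn-comm : ∀ a b → bothIn a b ≡ bothIn b a
    bothIn-comm a b = 𝟙-cong (mk⇔ swap swap) ((a ∈? D) ×-dec (b ∈? D)) ((b ∈? D) ×-dec (a ∈? D))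

    differenceCount : Fin v → ℕ
    differenceCount h = ∑[ d < v ] bothIn d (d ⊖ h)

    r₂-Dev : ∀ x y → r₂ (Dev G D) x y ≡ differenceCount (x ⊖ y)
    r₂-Dev x y = begin
      r₂ (Dev G D) x y
        ≡⟨ count-cong (λ _ → ∈-translate⇔ ×-⇔ ∈-translate⇔)
             (λ g → (x ∈? Dev G D g) ×-dec (y ∈? Dev G D g))
             (λ g → ((x ⊖ g) ∈? D) ×-dec ((y ⊖ g) ∈? D)) ⟩
      count (λ g → ((x ⊖ g) ∈? D) ×-dec ((y ⊖ g) ∈? D))
        ≡⟨ count≡∑𝟙 (λ g → ((x ⊖ g) ∈? D) ×-dec ((y ⊖ g) ∈? D)) ⟩
      ∑[ g < v ] bothIn (x ⊖ g) (y ⊖ g)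
        ≡⟨ ∑-reflect x _ ⟩
      ∑[ d < v ] bothIn (x ⊖ (x ⊖ d)) (y ⊖ (x ⊖ d))
        ≡⟨ sum-cong-≗ (λ d → cong₂ bothIn (x⊖[x⊖y]≡y x d) (y⊖[z⊖x]≡x⊖[z⊖y] d y x)) ⟩
      differenceCount (x ⊖ y) ∎
      where open ≡-Reasoning

    ∣translate∩translate∣ : ∀ x y → ∣ translate G D x ∩ translate G D y ∣ ≡ differenceCount (x ⊖ y)
    ∣translate∩translate∣ x y = begin
      ∣ translate G D x ∩ translate G D y ∣
        ≡⟨ ∣p∣≡∑𝟙 (translate G D x ∩ translate G D y) ⟩
      ∑[ z < v ] 𝟙 (z ∈? translate G D x ∩ translate G D y)
        ≡⟨ ∑𝟙-cong (λ _ → (∈-translate⇔ ×-⇔ ∈-translate⇔) ⇔-∘ ∩⇔×)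
             _ (λ z → ((z ⊖ x) ∈? D) ×-dec ((z ⊖ y) ∈? D)) ⟩
      ∑[ z < v ] bothIn (z ⊖ x) (z ⊖ y)
        ≡⟨ ∑-shift y _ ⟩
      ∑[ d < v ] bothIn (d ⊕ y ⊖ x) (d ⊕ y ⊖ y)
        ≡⟨ sum-cong-≗ (λ d → cong₂ bothIn ([x⊕y]⊖z≡x⊖[z⊖y] d y x) (//-rightDividesʳ y d)) ⟩
      ∑[ d < v ] bothIn (d ⊖ (x ⊖ y)) d
        ≡⟨ sum-cong-≗ (λ d → bothIn-comm (d ⊖ (x ⊖ y)) d) ⟩
      differenceCount (x ⊖ y) ∎
      where open ≡-Reasoning

    r₂-Dev≡∣translate∩translate∣ : ∀ x y → r₂ (Dev G D) x y ≡ ∣ translate G D x ∩ translate G D y ∣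
    r₂-Dev≡∣translate∩translate∣ x y = trans (r₂-Dev x y) (sym (∣translate∩translate∣ x y))

    ∣translate∣ : ∀ g → ∣ translate G D g ∣ ≡ ∣ D ∣
    ∣translate∣ g = begin
      ∣ translate G D g ∣                   ≡⟨ ∣p∣≡∑𝟙 (translate G D g) ⟩
      ∑[ z < v ] 𝟙 (z ∈? translate G D g)   ≡⟨ ∑𝟙-cong (λ _ → ∈-translate⇔) _ (λ z → (z ⊖ g) ∈? D) ⟩
      ∑[ z < v ] 𝟙 ((z ⊖ g) ∈? D)           ≡⟨ ∑-shift g _ ⟩
      ∑[ d < v ] 𝟙 ((d ⊕ g ⊖ g) ∈? D)       ≡⟨ sum-cong-≗ (λ d → cong (λ a → 𝟙 (a ∈? D)) (//-rightDividesʳ g d)) ⟩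
      ∑[ d < v ] 𝟙 (d ∈? D)                 ≡⟨ ∣p∣≡∑𝟙 D ⟨
      ∣ D ∣                                 ∎
      where open ≡-Reasoning

    differenceCount-0# : differenceCount 0# ≡ ∣ D ∣
    differenceCount-0# = begin
      ∑[ d < v ] bothIn d (d ⊖ 0#)   ≡⟨ sum-cong-≗ (λ d → cong (bothIn d) (x⊖0≡x d)) ⟩
      ∑[ d < v ] bothIn d d          ≡⟨ ∑𝟙-cong (λ _ → mk⇔ proj₁ (λ d∈D → d∈D , d∈D)) _ (_∈? D) ⟩
      ∑[ d < v ] 𝟙 (d ∈? D)          ≡⟨ ∣p∣≡∑𝟙 D ⟨
      ∣ D ∣                          ∎
      where open ≡-Reasoning

    ∑-differenceCount : ∑[ h < v ] differenceCount h ≡ ∣ D ∣ * ∣ D ∣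
    ∑-differenceCount = begin
      ∑[ h < v ] ∑[ d < v ] bothIn d (d ⊖ h)
        ≡⟨ ∑-comm (λ h d → bothIn d (d ⊖ h)) ⟩
      ∑[ d < v ] ∑[ h < v ] bothIn d (d ⊖ h)
        ≡⟨ sum-cong-≗ (λ d → ∑-reflect d _) ⟩
      ∑[ d < v ] ∑[ e < v ] bothIn d (d ⊖ (d ⊖ e))
        ≡⟨ sum-cong-≗ (λ d → sum-cong-≗ (λ e → cong (bothIn d) (x⊖[x⊖y]≡y d e))) ⟩
      ∑[ d < v ] ∑[ e < v ] bothIn d e
        ≡⟨ sum-cong-≗ (λ d → sum-cong-≗ (λ e → 𝟙-× (d ∈? D) (e ∈? D))) ⟩
      ∑[ d < v ] ∑[ e < v ] (𝟙 (d ∈? D) * 𝟙 (e ∈? D))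
        ≡⟨ sum-cong-≗ (λ d → *-distribˡ-sum (𝟙 (d ∈? D)) (λ e → 𝟙 (e ∈? D))) ⟨
      ∑[ d < v ] (𝟙 (d ∈? D) * ∑[ e < v ] 𝟙 (e ∈? D))
        ≡⟨ *-distribʳ-sum (∑[ e < v ] 𝟙 (e ∈? D)) (λ d → 𝟙 (d ∈? D)) ⟨
      ∑[ d < v ] 𝟙 (d ∈? D) * ∑[ e < v ] 𝟙 (e ∈? D)
        ≡⟨ cong₂ _*_ (∣p∣≡∑𝟙 D) (∣p∣≡∑𝟙 D) ⟨
      ∣ D ∣ * ∣ D ∣ ∎
      where open ≡-Reasoning

    diffMult≡differenceCount : ∀ {h} → h ≢ 0# → diffMult G D h ≡ differenceCount h
    diffMult≡differenceCount {h} h≢0 = begin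
      diffMult G D h
        ≡⟨ countPairs≡∑∑𝟙 difference? ⟩
      ∑[ x < v ] ∑[ y < v ] 𝟙 (difference? (x , y))
        ≡⟨ sum-cong-≗ (λ x → ∑-single _ (x ⊖ h) (λ y y≢x⊖h →
             𝟙-no (difference? (x , y)) (y≢x⊖h ∘ x⊖y≡h⇒y≡x⊖h x y))) ⟩
      ∑[ x < v ] 𝟙 (difference? (x , x ⊖ h))
        ≡⟨ ∑𝟙-cong (λ x → mk⇔ proj₁ (λ both∈D → both∈D , x≢x⊖h x , x⊖[x⊖y]≡y x h))
             _ (λ x → (x ∈? D) ×-dec ((x ⊖ h) ∈? D)) ⟩
      differenceCount h ∎
      where
      open ≡-Reasoning

      difference? : Decidable (λ p → (proj₁ p ∈ D × proj₂ p ∈ D) × (proj₁ p ≢ proj₂ p × proj₁ p ⊖ proj₂ p ≡ h))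
      difference? p = ((proj₁ p ∈? D) ×-dec (proj₂ p ∈? D))
                ×-dec (¬? (proj₁ p ≟ proj₂ p) ×-dec ((proj₁ p ⊖ proj₂ p) ≟ h))

      x⊖y≡h⇒y≡x⊖h : ∀ x y → (x ∈ D × y ∈ D) × (x ≢ y × x ⊖ y ≡ h) → y ≡ x ⊖ h
      x⊖y≡h⇒y≡x⊖h x y (_ , _ , x⊖y≡h) = trans (sym (x⊖[x⊖y]≡y x y)) (cong (x ⊖_) x⊖y≡h)

      x≢x⊖h : ∀ x → x ≢ x ⊖ h
      x≢x⊖h x x≡x⊖h = h≢0 (trans (sym (x⊖[x⊖y]≡y x h)) (trans (cong (x ⊖_) (sym x≡x⊖h)) (inverseʳ x)))

    ∣D∣≡v⇒differenceCount≡v : ∣ D ∣ ≡ v → ∀ h → differenceCount h ≡ v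
    ∣D∣≡v⇒differenceCount≡v ∣D∣≡v h = begin
      ∑[ d < v ] bothIn d (d ⊖ h)   ≡⟨ sum-cong-≗ (λ d → 𝟙-yes ((d ∈? D) ×-dec ((d ⊖ h) ∈? D)) (∈D , ∈D)) ⟩
      ∑[ d < v ] 1                  ≡⟨ ∑-const-1 v ⟩
      v                             ∎
      where
      open ≡-Reasoning

      ∈D : ∀ {d} → d ∈ D
      ∈D = subst (_ ∈_) (sym (∣p∣≡n⇒p≡⊤ ∣D∣≡v)) ∈⊤

    ∣D∣<v : ∀ {h₁ h₂} → differenceCount h₁ ≢ differenceCount h₂ → ∣ D ∣ < v
    ∣D∣<v {h₁} {h₂} dc₁≢dc₂ = ≤∧≢⇒< (∣p∣≤n D) (λ ∣D∣≡v →
      dc₁≢dc₂ (trans (∣D∣≡v⇒differenceCount≡v ∣D∣≡v h₁) (sym (∣D∣≡v⇒differenceCount≡v ∣D∣≡v h₂))))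

    2<∣D∣ : ∀ {h₁ h₂} → h₁ ≢ 0# → h₂ ≢ 0# →
      0 < differenceCount h₁ → differenceCount h₁ < differenceCount h₂ → 2 < ∣ D ∣
    2<∣D∣ {h₁} {h₂} h₁≢0 h₂≢0 0<dc₁ dc₁<dc₂ = k+3≤k*k⇒2<k ∣ D ∣ (begin
      ∣ D ∣ + 3
        ≤⟨ +-monoʳ-≤ ∣ D ∣ (+-mono-≤ 0<dc₁ (≤-trans (s≤s 0<dc₁) dc₁<dc₂)) ⟩
      ∣ D ∣ + (differenceCount h₁ + differenceCount h₂)
        ≡⟨ cong (_+ (differenceCount h₁ + differenceCount h₂)) differenceCount-0# ⟨
      differenceCount 0# + (differenceCount h₁ + differenceCount h₂)
        ≡⟨ +-assoc (differenceCount 0#) (differenceCount h₁) (differenceCount h₂) ⟨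
      differenceCount 0# + differenceCount h₁ + differenceCount h₂
        ≤⟨ ∑-≥-three-points differenceCount (h₁≢0 ∘ sym) (h₂≢0 ∘ sym) h₁≢h₂ ⟩
      ∑[ h < v ] differenceCount h
        ≡⟨ ∑-differenceCount ⟩
      ∣ D ∣ * ∣ D ∣ ∎)
      where
      open ≤-Reasoning

      h₁≢h₂ : h₁ ≢ h₂
      h₁≢h₂ refl = <-irrefl refl dc₁<dc₂

    Dev-not-2-design : ∀ {k h₁ h₂} → h₁ ≢ 0# → h₂ ≢ 0# → differenceCount h₁ ≢ differenceCount h₂ →
      ¬ (Σ ℕ λ μ → IsDesign (Dev G D) 2 k μ)
    Dev-not-2-design {h₁ = h₁} {h₂} h₁≢0 h₂≢0 dc₁≢dc₂ (μ , _ , _ , _ , _ , pairs≡μ) =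
      dc₁≢dc₂ (trans (sym (μ≡differenceCount h₁≢0)) (μ≡differenceCount h₂≢0))
      where
      μ≡differenceCount : ∀ {h} → h ≢ 0# → μ ≡ differenceCount h
      μ≡differenceCount {h} h≢0 = begin
        μ                                                 ≡⟨ pairs≡μ (⁅ h ⁆ ∪ ⁅ 0# ⁆) (∣⁅x⁆∪⁅y⁆∣≡2 h≢0) ⟨
        blocksContaining (Dev G D) (⁅ h ⁆ ∪ ⁅ 0# ⁆)       ≡⟨ blocksContaining-⁅x⁆∪⁅y⁆ (Dev G D) h 0# ⟩
        r₂ (Dev G D) h 0#                                 ≡⟨ r₂-Dev h 0# ⟩
        differenceCount (h ⊖ 0#)                          ≡⟨ cong differenceCount (x⊖0≡x h) ⟩
        differenceCount h                                 ∎
        where open ≡-Reasoning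

-- Almost difference sets

module _ {v : ℕ} (G : FinAbGroup v) (D : Subset v) {k lam s : ℕ} where
  open FinAbGroup G using (0#) renaming (_-_ to _⊖_)

  private
    λ-difference? : Decidable (λ h → h ≢ 0# × diffMult G D h ≡ lam)
    λ-difference? h = ¬? (h ≟ 0#) ×-dec (diffMult G D h ℕ.≟ lam)

  ADS-differenceCount-dichotomy : IsADS G D k lam s → ∀ {h} → h ≢ 0# →
    differenceCount G D h ≡ lam ⊎ differenceCount G D h ≡ suc lam
  ADS-differenceCount-dichotomy (_ , _ , _ , _ , dichotomy) {h} h≢0 =
    Sum.map (trans dc≡dM) (trans dc≡dM) (dichotomy h h≢0)
    where
    dc≡dM : differenceCount G D h ≡ diffMult G D h
    dc≡dM = sym (diffMult≡differenceCount G D h≢0)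

  ADS-r₂-dichotomy : IsADS G D k lam s → ∀ {x y} → x ≢ y →
    r₂ (Dev G D) x y ≡ lam ⊎ r₂ (Dev G D) x y ≡ suc lam
  ADS-r₂-dichotomy ads {x} {y} x≢y =
    Sum.map (trans (r₂-Dev G D x y)) (trans (r₂-Dev G D x y))
      (ADS-differenceCount-dichotomy ads (x≢y⇒x⊖y≢0# G x≢y))

  ADS-∃differenceCount≡λ : IsADS G D k lam s → ∃ λ h → h ≢ 0# × differenceCount G D h ≡ lam
  ADS-∃differenceCount≡λ (_ , 0<s , _ , count≡s , _) =
    let h , h≢0 , dM≡lam = ∑𝟙-witness λ-difference?
                             (subst (0 <_) (trans (sym count≡s) (count≡∑𝟙 λ-difference?)) 0<s)
    in h , h≢0 , trans (sym (diffMult≡differenceCount G D h≢0)) dM≡lam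

  ADS-∃differenceCount≡1+λ : IsADS G D k lam s → ∃ λ h → h ≢ 0# × differenceCount G D h ≡ suc lam
  ADS-∃differenceCount≡1+λ ads@(_ , _ , s<v∸1 , count≡s , _)
    with any? (λ h → ¬? (h ≟ 0#) ×-dec ¬? (differenceCount G D h ℕ.≟ lam))
  ... | yes (h , h≢0 , dc≢lam) =
    h , h≢0 , [ flip contradiction dc≢lam , id ]′ (ADS-differenceCount-dichotomy ads h≢0)
  ... | no ∄ = contradiction s≡v∸1 (<⇒≢ s<v∸1)
    where
    dM≡lam : ∀ {h} → h ≢ 0# → diffMult G D h ≡ lam
    dM≡lam {h} h≢0 = trans (diffMult≡differenceCount G D h≢0)
      (decidable-stable (differenceCount G D h ℕ.≟ lam) (λ dc≢lam → ∄ (h , h≢0 , dc≢lam)))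

    s≡v∸1 : s ≡ v ∸ 1
    s≡v∸1 = begin
      s                            ≡⟨ count≡s ⟨
      count λ-difference?          ≡⟨ count-cong (λ _ → mk⇔ proj₁ (λ h≢0 → h≢0 , dM≡lam h≢0))
                                                 λ-difference? (λ h → ¬? (h ≟ 0#)) ⟩
      count (λ h → ¬? (h ≟ 0#))    ≡⟨ count≡∑𝟙 (λ h → ¬? (h ≟ 0#)) ⟩
      ∑[ h < v ] 𝟙 (¬? (h ≟ 0#))   ≡⟨ ∑𝟙-≢≡n∸1 0# ⟩
      v ∸ 1                        ∎
      where open ≡-Reasoning

lemma1 : ∀ {v : ℕ} (G : FinAbGroup v) (D : Subset v) (k lam s : ℕ)
         → IsADS G D k lam s
         → 0 < lam
         → IsAdesign (Dev G D) 2 k lam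
           × (∀ (x y : Fin v) → x ≢ y
                → (∣ translate G D x ∩ translate G D y ∣ ≡ lam → r₂ (Dev G D) x y ≡ lam)
                × (∣ translate G D x ∩ translate G D y ∣ ≢ lam → r₂ (Dev G D) x y ≡ suc lam))
lemma1 {v} G D k lam s ads@(∣D∣≡k , _) 0<lam =
  let h₁ , h₁≢0 , dc₁≡λ   = ADS-∃differenceCount≡λ G D ads
      h₂ , h₂≢0 , dc₂≡1+λ = ADS-∃differenceCount≡1+λ G D ads
      dc₁<dc₂ = subst₂ _<_ (sym dc₁≡λ) (sym dc₂≡1+λ) (n<1+n lam)
  in
  ( (λ g → trans (∣translate∣ G D g) ∣D∣≡k)
  , s≤s z≤n
  , subst (2 <_) ∣D∣≡k (2<∣D∣ G D h₁≢0 h₂≢0 (subst (0 <_) (sym dc₁≡λ) 0<lam) dc₁<dc₂)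
  , subst (_< v) ∣D∣≡k (∣D∣<v G D (<⇒≢ dc₁<dc₂))
  , 0<lam
  , (λ T ∣T∣≡2 → let x , y , x≢y , bc≡r₂ = blocksContaining-2-subset (Dev G D) T ∣T∣≡2
                 in Sum.map (trans bc≡r₂) (trans bc≡r₂) (ADS-r₂-dichotomy G D ads x≢y))
  , Dev-not-2-design G D h₁≢0 h₂≢0 (<⇒≢ dc₁<dc₂) )
  , λ x y x≢y →
      let r₂≡∩ = r₂-Dev≡∣translate∩translate∣ G D x y
      in trans r₂≡∩
       , λ ∩≢λ → [ (λ r₂≡λ → contradiction (trans (sym r₂≡∩) r₂≡λ) ∩≢λ) , id ]′
                   (ADS-r₂-dichotomy G D ads x≢y)
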